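{- Let $P$ be a GPEA, $\gamma$ a unitizing automorphism of $P$, and $U$ the $\gamma$-unitization of $P$. If $I$ is a normal Riesz ideal in $U$, then its restriction $I\cap P$ to $P$ is a $\gamma$-closed normal Riesz ideal in $P$.
   Context: A GPEA is $(P;\oplus,0)$ with partial $\oplus$ satisfying partial associativity, conjugation ($a\oplus b=c\oplus a=b\oplus d$ for some $c,d$), two-sided cancellation, neutral $0$, positivity. Order $a\le b$ iff $a\oplus c=b$ for some $c$; for $a\le b$, $a/b$ is the unique $c$ with $a\oplus c=b$ and $b\backslash a$ the unique $d$ with $d\oplus a=b$. A unitizing automorphism $\gamma$ is a GPEA-automorphism with $\gamma a\oplus b$ defined iff $b\oplus a$ defined. The $\gamma$-unitization $U=P\cup P^\eta$ ($\eta\colon P\to P^\eta$ bijection onto a disjoint set, $1:=\eta0$): sums in $P$ as in $P$; $a+\eta b$ defined iff $a\le b$, equal to $\eta(b\backslash a)$; $\eta a+b$ defined iff $\gamma b\le a$, equal to $\eta(\gamma b/a)$; no sums within $P^\eta$. $U$ is a pseudo effect algebra with $\eta a=a^\sim$, $\gamma a=a^{ -- }$. Ideal: nonempty down-set closed under existing sums; normal: $a\oplus c=c\oplus b$ implies ($a\in I\Leftrightarrow b\in I$). Riesz ideal: satisfies (R1) if $i\in I$, $i\le a\oplus b$, then $i\le j\oplus k$ for some $j,k\in I$, $j\le a$, $k\le b$; and (R2) if $i\in I$, $i\le a$, then (i) if $(a\backslash i)\oplus b$ exists there is $j\in I$, $j\le b$, with $a\oplus(j/b)$ existing, (ii) if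 $b\oplus(i/a)$ exists there is $k\in I$, $k\le b$, with $(b\backslash k)\oplus a$ existing. An ideal $J$ of $P$ is $\gamma$-closed iff $a\in J\Leftrightarrow\gamma a\in J$ for all $a\in P$. -}

module Defs where

open import Level using (Level; _⊔_; suc)
open import Data.Product using (Σ; _×_; _,_; ∃-syntax)
open import Data.Sum using (_⊎_; inj₁; inj₂)
open import Data.Empty.Polymorphic using (⊥)
open import Relation.Binary.PropositionalEquality using (_≡_)
open import Relation.Unary using (Pred; _∈_)

-- A partial binary operation is represented by its graph:
-- `Sum a b c` means "a ⊕ b is defined and equals c".

module PartialAlg {c : Level} {A : Set c} (Sum : A → A → A → Set c) where

  Def : A → A → Set c
  Def a b = Σ A λ e → Sum a b e

  _≤_ : A → A → Set c
  a ≤ b = Σ A λ x → Sum a x b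

  record IsIdeal {ℓ} (I : Pred A ℓ) : Set (c ⊔ ℓ) where
    field
      nonempty  : Σ A λ x → x ∈ I
      downward  : ∀ {a b} → a ≤ b → b ∈ I → a ∈ I
      sumClosed : ∀ {a b e} → Sum a b e → a ∈ I → b ∈ I → e ∈ I

  IsNormal : ∀ {ℓ} → Pred A ℓ → Set (c ⊔ ℓ)
  IsNormal I = ∀ {a x b e} → Sum a x e → Sum x b e → (a ∈ I → b ∈ I) × (b ∈ I → a ∈ I)

  R1 : ∀ {ℓ} → Pred A ℓ → Set (c ⊔ ℓ)
  R1 I = ∀ {i a b s} → i ∈ I → Sum a b s → i ≤ s →
         Σ A λ j → Σ A λ k → j ∈ I × k ∈ I × j ≤ a × k ≤ b ×
           (Σ A λ t → Sum j k t × i ≤ t)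

  -- (R2)(i): i ∈ I, i ≤ a, (a\i) ⊕ b exists  ⇒
  --   ∃ j ∈ I, j ≤ b, with a ⊕ (j/b) existing.
  -- Here d with d ⊕ i = a is a\i, and y with j ⊕ y = b is j/b.
  R2i : ∀ {ℓ} → Pred A ℓ → Set (c ⊔ ℓ)
  R2i I = ∀ {i a b d} → i ∈ I → Sum d i a → Def d b →
          Σ A λ j → j ∈ I × (Σ A λ y → Sum j y b × Def a y)

  -- (R2)(ii): i ∈ I, i ≤ a, b ⊕ (i/a) exists  ⇒
  --   ∃ k ∈ I, k ≤ b, with (b\k) ⊕ a existing.
  -- Here y with i ⊕ y = a is i/a, and z with z ⊕ k = b is b\k.
  R2ii : ∀ {ℓ} → Pred A ℓ → Set (c ⊔ ℓ)
  R2ii I = ∀ {i a b y} → i ∈ I → Sum i y a → Def b y →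
           Σ A λ k → k ∈ I × (Σ A λ z → Sum z k b × Def z a)

  record IsNormalRieszIdeal {ℓ} (I : Pred A ℓ) : Set (c ⊔ ℓ) where
    field
      ideal  : IsIdeal I
      normal : IsNormal I
      r1     : R1 I
      r2i    : R2i I
      r2ii   : R2ii I

record GPEA (c : Level) : Set (suc c) where
  field
    Carrier : Set c
    Sum     : Carrier → Carrier → Carrier → Set c
    𝟘       : Carrier
  open PartialAlg Sum
  field
    functional : ∀ {a b e e'} → Sum a b e → Sum a b e' → e ≡ e'
    assocˡ : ∀ {a b x d e} → Sum a b d → Sum d x e →
             Σ Carrier λ f → Sum b x f × Sum a f e
    assocʳ : ∀ {a b x f e} → Sum b x f → Sum a f e →
             Σ Carrier λ d → Sum a b d × Sum d x e
    conjugation : ∀ {a b e} → Sum a b e →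
                  (Σ Carrier λ x → Sum x a e) × (Σ Carrier λ y → Sum b y e)
    cancelˡ : ∀ {a b x e} → Sum a b e → Sum a x e → b ≡ x
    cancelʳ : ∀ {a b x e} → Sum b a e → Sum x a e → b ≡ x
    neutralˡ : ∀ a → Sum 𝟘 a a
    neutralʳ : ∀ a → Sum a 𝟘 a
    positivity : ∀ {a b} → Sum a b 𝟘 → a ≡ 𝟘

module _ {c : Level} (P : GPEA c) where
  open GPEA P
  open PartialAlg Sum

  record IsAutomorphism (γ : Carrier → Carrier) : Set c where
    field
      γ⁻¹      : Carrier → Carrier
      inverseˡ : ∀ a → γ⁻¹ (γ a) ≡ a
      inverseʳ : ∀ a → γ (γ⁻¹ a) ≡ a
      hom      : ∀ {a b e} → Sum a b e → Sum (γ a) (γ b) (γ e)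
      hom⁻¹    : ∀ {a b e} → Sum (γ a) (γ b) (γ e) → Sum a b e

  record IsUnitizing (γ : Carrier → Carrier) : Set c where
    field
      automorphism : IsAutomorphism γ
      unitizing₁   : ∀ {a b} → Def (γ a) b → Def b a
      unitizing₂   : ∀ {a b} → Def b a → Def (γ a) b

  -- Carrier of the γ-unitization: inj₁ a ↦ a ∈ P, inj₂ a ↦ η a ∈ P^η
  UCarrier : Set c
  UCarrier = Carrier ⊎ Carrier

  USum : (Carrier → Carrier) → UCarrier → UCarrier → UCarrier → Set c
  USum γ (inj₁ a) (inj₁ b) (inj₁ e) = Sum a b e
  -- a + η b defined iff a ≤ b, equal to η (b \ a), b\a = d with d ⊕ a = b
  USum γ (inj₁ a) (inj₂ b) (inj₂ d) = Sum d a b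
  -- η a + b defined iff γ b ≤ a, equal to η (γ b / a), γb/a = x with γ b ⊕ x = a
  USum γ (inj₂ a) (inj₁ b) (inj₂ x) = Sum (γ b) x a
  USum γ _ _ _ = ⊥

  restrict : ∀ {ℓ} → Pred UCarrier ℓ → Pred Carrier ℓ
  restrict I a = I (inj₁ a)

  IsγClosed : ∀ {ℓ} → (Carrier → Carrier) → Pred Carrier ℓ → Set (c ⊔ ℓ)
  IsγClosed γ J = ∀ a → (a ∈ J → γ a ∈ J) × (γ a ∈ J → a ∈ J)

module Submission where

-- The whole argument rests on one structural fact: P sits inside U as a
-- down-set that is closed under the sums of U.  Concretely, if x ⊕ y lands
-- in P then x and y are in P (no sum in U involving an η-element lands in P),
-- and a sum of two elements of P is again in P.  Consequently the U-order,
-- U-definedness and U-sums between elements of P are exactly those of P.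
-- Every axiom of a normal Riesz ideal for I ∩ P is then obtained by applying
-- the corresponding axiom of I to elements of P and observing that all the
-- witnesses it produces lie below (or sum to) elements of P, hence in P.
-- Finally, γ-closedness comes from normality of I applied to the identity
--   γa ⊕ η(γa) = η0 = η(γa) ⊕ a   in U.

open import Defs
open import Level using (Level; lift)
open import Data.Product using (_×_; _,_)
open import Data.Sum using (inj₁; inj₂)
open import Relation.Unary using (Pred)

module Unitization {c : Level} (P : GPEA c) (γ : GPEA.Carrier P → GPEA.Carrier P) where
  open GPEA P
  module U = PartialAlg (USum P γ)
  module Q = PartialAlg Sum

  data InP : UCarrier P → Set c where
    ⌜_⌝ : (a : Carrier) → InP (inj₁ a)

  summandsInP : ∀ {x y e} → USum P γ x y (inj₁ e) → InP x × InP y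
  summandsInP {inj₁ a} {inj₁ b} _        = ⌜ a ⌝ , ⌜ b ⌝
  summandsInP {inj₁ _} {inj₂ _} (lift ())
  summandsInP {inj₂ _} {inj₁ _} (lift ())
  summandsInP {inj₂ _} {inj₂ _} (lift ())

  belowInP : ∀ {x b} → x U.≤ inj₁ b → InP x
  belowInP (_ , s) with summandsInP s
  ... | x∈P , _ = x∈P

  sumInP : ∀ {a b t} → USum P γ (inj₁ a) (inj₁ b) t → InP t
  sumInP {t = inj₁ t} _        = ⌜ t ⌝
  sumInP {t = inj₂ _} (lift ())

  ≤-embed : ∀ {a b} → a Q.≤ b → inj₁ a U.≤ inj₁ b
  ≤-embed (x , s) = inj₁ x , s

  ≤-reflect : ∀ {a b} → inj₁ a U.≤ inj₁ b → a Q.≤ b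
  ≤-reflect (inj₁ x , s)        = x , s
  ≤-reflect (inj₂ _ , lift ())

  def-embed : ∀ {a b} → Q.Def a b → U.Def (inj₁ a) (inj₁ b)
  def-embed (e , s) = inj₁ e , s

  def-reflect : ∀ {a b} → U.Def (inj₁ a) (inj₁ b) → Q.Def a b
  def-reflect (inj₁ e , s)        = e , s
  def-reflect (inj₂ _ , lift ())

  -- 0 is the least element of U (for x = η a: 0 ⊕ η a = η (a \ 0) = η a).
  zero-least : ∀ x → inj₁ 𝟘 U.≤ x
  zero-least (inj₁ a) = inj₁ a , neutralˡ a
  zero-least (inj₂ a) = inj₂ a , neutralʳ a

  -- γa ⊕ η(γa) = 1 = η(γa) ⊕ a, where 1 = η 0: the element a^{--} = γa and
  -- a are conjugate in U through the common complement η(γa).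
  γ-conjugate : ∀ a → USum P γ (inj₁ (γ a)) (inj₂ (γ a)) (inj₂ 𝟘)
                    × USum P γ (inj₂ (γ a)) (inj₁ a) (inj₂ 𝟘)
  γ-conjugate a = neutralˡ (γ a) , neutralʳ (γ a)

module Restriction {c ℓ : Level} (P : GPEA c) (γ : GPEA.Carrier P → GPEA.Carrier P)
  (I : Pred (UCarrier P) ℓ) (I-nr : PartialAlg.IsNormalRieszIdeal (USum P γ) I) where
  open GPEA P
  open Unitization P γ
  open U.IsNormalRieszIdeal I-nr
  open U.IsIdeal ideal

  J : Pred Carrier ℓ
  J = restrict P I

  zero∈J : J 𝟘
  zero∈J with nonempty
  ... | x , x∈I = downward (zero-least x) x∈I

  J-ideal : Q.IsIdeal J
  J-ideal = record
    { nonempty  = 𝟘 , zero∈J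
    ; downward  = λ a≤b → downward (≤-embed a≤b)
    ; sumClosed = λ {a} {b} {e} s → sumClosed {inj₁ a} {inj₁ b} {inj₁ e} s
    }

  J-normal : Q.IsNormal J
  J-normal {a} {x} {b} {e} = normal {inj₁ a} {inj₁ x} {inj₁ b} {inj₁ e}

  -- The witnesses j, k of (R1) in U lie below a, b ∈ P, and their sum t lies
  -- above i ∈ P; all of them are therefore in P.
  J-r1 : Q.R1 J
  J-r1 {i} {a} {b} {s} i∈J a⊕b i≤s
    with r1 {inj₁ i} {inj₁ a} {inj₁ b} {inj₁ s} i∈J a⊕b (≤-embed i≤s)
  ... | j , k , j∈I , k∈I , j≤a , k≤b , t , j⊕k , i≤t
    with belowInP {j} j≤a | belowInP {k} k≤b
  ... | ⌜ j′ ⌝ | ⌜ k′ ⌝ with sumInP {t = t} j⊕k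
  ... | ⌜ t′ ⌝ = j′ , k′ , j∈I , k∈I , ≤-reflect j≤a , ≤-reflect k≤b ,
                 t′ , j⊕k , ≤-reflect i≤t

  -- The witnesses of (R2)(i) are summands of b ∈ P, hence in P.
  J-r2i : Q.R2i J
  J-r2i {i} {a} {b} {d} i∈J d⊕i d⊕b
    with r2i {inj₁ i} {inj₁ a} {inj₁ b} {inj₁ d} i∈J d⊕i (def-embed d⊕b)
  ... | j , j∈I , y , j⊕y , a⊕y with summandsInP {j} {y} j⊕y
  ... | ⌜ j′ ⌝ , ⌜ y′ ⌝ = j′ , j∈I , y′ , j⊕y , def-reflect a⊕y

  -- The witnesses of (R2)(ii) are summands of b ∈ P, hence in P.
  J-r2ii : Q.R2ii J
  J-r2ii {i} {a} {b} {y} i∈J i⊕y b⊕y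
    with r2ii {inj₁ i} {inj₁ a} {inj₁ b} {inj₁ y} i∈J i⊕y (def-embed b⊕y)
  ... | k , k∈I , z , z⊕k , z⊕a with summandsInP {z} {k} z⊕k
  ... | ⌜ z′ ⌝ , ⌜ k′ ⌝ = k′ , k∈I , z′ , z⊕k , def-reflect z⊕a

  J-normalRiesz : Q.IsNormalRieszIdeal J
  J-normalRiesz = record
    { ideal = J-ideal ; normal = J-normal ; r1 = J-r1 ; r2i = J-r2i ; r2ii = J-r2ii }

  J-γClosed : IsγClosed P γ J
  J-γClosed a with γ-conjugate a
  ... | γa⊕η , η⊕a with normal {inj₁ (γ a)} {inj₂ (γ a)} {inj₁ a} {inj₂ 𝟘} γa⊕η η⊕a
  ... | γa∈I⇒a∈I , a∈I⇒γa∈I = a∈I⇒γa∈I , γa∈I⇒a∈I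

theorem4p14 : ∀ {c ℓ : Level} (P : GPEA c) (γ : GPEA.Carrier P → GPEA.Carrier P) →
    IsUnitizing P γ → (I : Pred (UCarrier P) ℓ) →
    PartialAlg.IsNormalRieszIdeal (USum P γ) I →
    PartialAlg.IsNormalRieszIdeal (GPEA.Sum P) (restrict P I) × IsγClosed P γ (restrict P I)
theorem4p14 P γ _ I I-nr = J-normalRiesz , J-γClosed
  where open Restriction P γ I I-nr
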